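{- Let $w$ be an infinite word over a finite alphabet $A$ and let $B \subseteq A$ contain at least two different letters. The following assertions are equivalent: (1) $w$ is ultimately $B$-strict epistandard, i.e. $w$ is epistandard and $Ult(\Delta(w)) = B$; (2) for each letter $a \in A$, the word $aw$ is episturmian if and only if $a \in B$.
   Context: $Fact(w)$ is the set of factors of $w$. A factor $u$ of $w$ is left special if there are two different letters $a,b$ with $au, bu$ factors of $w$. An infinite word $w$ is episturmian if $Fact(w)$ is closed under mirror image (reversal) and $w$ has at most one left special factor of each length; it is epistandard if it is episturmian and all its left special factors are prefixes of $w$. For a letter $a$, $L_a$ is the morphism with $L_a(a)=a$ and $L_a(b)=ab$ for $b\ne a$. An infinite word $s$ is epistandard if and only if there are a sequence of letters $(x_n)_{n\ge1}$ and infinite words $s^{(n)}$ with $s^{(0)}=s$ and $s^{(n-1)}=L_{x_n}(s^{(n)})$ for all $n\geq 1$; the directive word $\Delta(s)=(x_n)_{n\ge1}$ is this sequence (unique for each epistandard word). $Ult(\Delta(w))$ is the set of letters occurring infinitely often in $\Delta(w)$. -}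

module Defs where

open import Data.Nat using (ℕ; zero; suc; _+_; _≤_)
open import Data.Fin using (Fin; _≟_)
open import Data.Fin.Subset using (Subset; _∈_)
open import Data.List using (List; []; _∷_; length; reverse)
open import Data.Product using (Σ; ∃; ∃-syntax; _×_; _,_)
open import Relation.Binary.PropositionalEquality using (_≡_; _≢_)
open import Relation.Nullary using (yes; no)
open import Function.Bundles using (_⇔_)

Word : ℕ → Set
Word k = ℕ → Fin k

pref : ∀ {k} → Word k → ℕ → List (Fin k)
pref w zero = []
pref w (suc n) = w 0 ∷ pref (λ i → w (suc i)) n

shift : ∀ {k} → Word k → ℕ → Word k
shift w i j = w (i + j)

cons : ∀ {k} → Fin k → Word k → Word k
cons a w zero = a
cons a w (suc n) = w n

IsPrefix : ∀ {k} → List (Fin k) → Word k → Set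
IsPrefix u w = pref w (length u) ≡ u

Factor : ∀ {k} → List (Fin k) → Word k → Set
Factor u w = ∃[ i ] IsPrefix u (shift w i)

MirrorClosed : ∀ {k} → Word k → Set
MirrorClosed w = ∀ u → Factor u w → Factor (reverse u) w

LeftSpecial : ∀ {k} → List (Fin k) → Word k → Set
LeftSpecial {k} u w = Σ (Fin k) λ a → Σ (Fin k) λ b →
  a ≢ b × Factor (a ∷ u) w × Factor (b ∷ u) w

Episturmian : ∀ {k} → Word k → Set
Episturmian w = MirrorClosed w ×
  (∀ u v → length u ≡ length v → LeftSpecial u w → LeftSpecial v w → u ≡ v)

Epistandard : ∀ {k} → Word k → Set
Epistandard w = Episturmian w × (∀ u → LeftSpecial u w → IsPrefix u w)

Lword : ∀ {k} → Fin k → List (Fin k) → List (Fin k)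
Lword a [] = []
Lword a (b ∷ u) with b ≟ a
... | yes _ = a ∷ Lword a u
... | no _ = a ∷ b ∷ Lword a u

-- s = L_a(t) for infinite words s, t: since L_a is non-erasing, L_a(t) is the
-- unique infinite word having every L_a(prefix of t) as a prefix.
IsLImage : ∀ {k} → Fin k → Word k → Word k → Set
IsLImage a t s = ∀ n → IsPrefix (Lword a (pref t n)) s

-- x is a directive word of s (x 0 plays the role of x_1):
-- there are infinite words s⁽ⁿ⁾ with s⁽⁰⁾ = s and s⁽ⁿ⁾ = L_{x_{n+1}}(s⁽ⁿ⁺¹⁾).
Directive : ∀ {k} → Word k → (ℕ → Fin k) → Set
Directive {k} s x = Σ (ℕ → Word k) λ t →
  (∀ i → t 0 i ≡ s i) × (∀ n → IsLImage (x n) (t (suc n)) (t n))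

InfOften : ∀ {k} → (ℕ → Fin k) → Fin k → Set
InfOften x b = ∀ N → ∃[ n ] (N ≤ n × x n ≡ b)

UltStrictEpistandard : ∀ {k} → Word k → Subset k → Set
UltStrictEpistandard w B = Epistandard w ×
  ∃[ x ] (Directive w x × (∀ b → InfOften x b ⇔ b ∈ B))

TwoLetters : ∀ {k} → Subset k → Set
TwoLetters {k} B = Σ (Fin k) λ a → Σ (Fin k) λ b → a ≢ b × a ∈ B × b ∈ B

{-# OPTIONS --safe #-}
-- A mirror-closed word is recurrent, so if c w is episturmian then every factor
-- of c w is a factor of w: c is a left extension of w. Two different left
-- extensions make every prefix of w left special, hence w is epistandard; and an
-- epistandard s factorises as L_{s 0}(t) with t epistandard, since every letter
-- other than s 0 is preceded by s 0, which yields a directive word x with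
-- s⁽ⁿ⁾ = L_{x n}(s⁽ⁿ⁺¹⁾). For any directive word, c occurs infinitely often in x
-- iff c is a left extension of w: left extensions descend from s⁽ⁿ⁾ to s⁽ⁿ⁺¹⁾,
-- and a letter c ≠ x n of s⁽ⁿ⁾ comes from an earlier position of s⁽ⁿ⁺¹⁾, so c
-- reaches some x m with m ≥ n; conversely each L_{x n} lengthens a prefix that c
-- extends on the left, so an occurrence x N = c gives such prefixes of length N.
module Submission where

open import Defs
open import Data.Empty using (⊥-elim)
open import Data.Fin using (Fin; _≟_)
open import Data.Fin.Subset using (Subset; _∈_)
open import Data.List using (List; []; _∷_; length; reverse; _++_; [_])
open import Data.List.Properties
  using (∷-injective; ++-assoc; length-reverse; reverse-++; reverse-involutive; unfold-reverse)
open import Data.Nat using (ℕ; zero; suc; _+_; _≤_; _<_; z≤n; s≤s; z<s)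
open import Data.Nat.Induction using (<-wellFounded)
open import Data.Nat.Properties using (+-suc; +-assoc; +-identityʳ; m≤n⇒m≤1+n; ≤-refl; ≤-trans; <⇒≤)
open import Data.Product using (∃-syntax; _×_; _,_; proj₁; proj₂)
open import Data.Sum using (_⊎_; inj₁; inj₂)
open import Function.Base using (_∘_)
open import Function.Bundles using (_⇔_; mk⇔; Equivalence)
open import Function.Properties.Equivalence using () renaming (trans to ⇔-trans; sym to ⇔-sym)
open import Induction.WellFounded using (Acc; acc)
open import Relation.Binary.PropositionalEquality
  using (_≡_; _≢_; _≗_; ≢-sym; refl; sym; trans; cong; cong₂; subst; module ≡-Reasoning)
open import Relation.Nullary using (¬_; Dec; yes; no)
open import Relation.Nullary.Decidable using (decidable-stable)

private variable
  k i m n p : ℕ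
  x : ℕ → Fin k
  a b c d : Fin k
  s s′ t w : Word k
  u v z : List (Fin k)
  P Q : Word k → Set

-- Inductive counterparts of IsPrefix and Factor (see Occurs below): unlike those
-- functions, a data type and a record determine the word, which can stay implicit.
data Prefix : List (Fin k) → Word k → Set where
  []  : Prefix [] s
  _∷_ : s 0 ≡ b → Prefix u (shift s 1) → Prefix (b ∷ u) s

shift-0 : ∀ (s : Word k) p → shift s p 0 ≡ s p
shift-0 s p = cong s (+-identityʳ p)

Prefix-cong : s ≗ s′ → Prefix u s → Prefix u s′
Prefix-cong s≗s′ []         = []
Prefix-cong s≗s′ (s₀≡b ∷ p) = trans (sym (s≗s′ 0)) s₀≡b ∷ Prefix-cong (s≗s′ ∘ suc) p

Prefix⇒IsPrefix : Prefix u s → IsPrefix u s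
Prefix⇒IsPrefix []         = refl
Prefix⇒IsPrefix (s₀≡b ∷ p) = cong₂ _∷_ s₀≡b (Prefix⇒IsPrefix p)

IsPrefix⇒Prefix : ∀ u → IsPrefix u s → Prefix u s
IsPrefix⇒Prefix []      _  = []
IsPrefix⇒Prefix (b ∷ u) eq = proj₁ (∷-injective eq) ∷ IsPrefix⇒Prefix u (proj₂ (∷-injective eq))

Prefix-∷-shift⁻ : ∀ (s : Word k) p →
                  Prefix (b ∷ u) (shift s p) → s p ≡ b × Prefix u (shift s (suc p))
Prefix-∷-shift⁻ s p (sₚ≡b ∷ q) =
  trans (sym (shift-0 s p)) sₚ≡b , Prefix-cong (λ j → cong s (+-suc p j)) q

Prefix-∷-shift⁺ : ∀ (s : Word k) p →
                  s p ≡ b → Prefix u (shift s (suc p)) → Prefix (b ∷ u) (shift s p)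
Prefix-∷-shift⁺ s p sₚ≡b q =
  trans (shift-0 s p) sₚ≡b ∷ Prefix-cong (λ j → cong s (sym (+-suc p j))) q

Prefix-pref : ∀ (s : Word k) n → Prefix (pref s n) s
Prefix-pref s zero    = []
Prefix-pref s (suc n) = refl ∷ Prefix-pref (shift s 1) n

length-pref : ∀ (s : Word k) n → length (pref s n) ≡ n
length-pref s zero    = refl
length-pref s (suc n) = cong suc (length-pref (shift s 1) n)

pref-cong : s ≗ s′ → ∀ n → pref s n ≡ pref s′ n
pref-cong s≗s′ zero    = refl
pref-cong s≗s′ (suc n) = cong₂ _∷_ (s≗s′ 0) (pref-cong (s≗s′ ∘ suc) n)

Prefix-pref-≤ : ∀ (s : Word k) → m ≤ n → Prefix (pref s n) s′ → Prefix (pref s m) s′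
Prefix-pref-≤ s z≤n       _            = []
Prefix-pref-≤ s (s≤s m≤n) (s′₀≡s₀ ∷ p) = s′₀≡s₀ ∷ Prefix-pref-≤ (shift s 1) m≤n p

Prefix-++⁻ : ∀ u → Prefix (u ++ v) s → Prefix u s × Prefix v (shift s (length u))
Prefix-++⁻ []      p          = [] , p
Prefix-++⁻ (b ∷ u) (s₀≡b ∷ p) = s₀≡b ∷ proj₁ (Prefix-++⁻ u p) , proj₂ (Prefix-++⁻ u p)

Prefix-++⁺ : Prefix u s → Prefix v (shift s (length u)) → Prefix (u ++ v) s
Prefix-++⁺ []         q = q
Prefix-++⁺ (s₀≡b ∷ p) q = s₀≡b ∷ Prefix-++⁺ p q

Prefix-pref-++ : ∀ (s : Word k) i → Prefix u (shift s i) → Prefix (pref s i ++ u) s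
Prefix-pref-++ s zero    p = p
Prefix-pref-++ s (suc i) p = refl ∷ Prefix-pref-++ (shift s 1) i p

Prefix-++-next : Prefix u s → Prefix (u ++ [ s (length u) ]) s
Prefix-++-next []         = refl ∷ []
Prefix-++-next (s₀≡b ∷ p) = s₀≡b ∷ Prefix-++-next p

record Occurs (u : List (Fin k)) (s : Word k) : Set where
  constructor at
  field
    position : ℕ
    prefix   : Prefix u (shift s position)

Occurs⇒Factor : Occurs u s → Factor u s
Occurs⇒Factor (at i p) = i , Prefix⇒IsPrefix p

Factor⇒Occurs : ∀ u → Factor u s → Occurs u s
Factor⇒Occurs u (i , eq) = at i (IsPrefix⇒Prefix u eq)

Occurs-cong : s ≗ s′ → Occurs u s → Occurs u s′
Occurs-cong s≗s′ (at i p) = at i (Prefix-cong (s≗s′ ∘ (i +_)) p)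

Occurs-shift : ∀ i → Occurs u (shift s i) → Occurs u s
Occurs-shift {s = s} i (at j p) = at (i + j) (Prefix-cong (λ l → cong s (sym (+-assoc i j l))) p)

Occurs-++⁻ˡ : ∀ u → Occurs (u ++ v) s → Occurs u s
Occurs-++⁻ˡ u (at i p) = at i (proj₁ (Prefix-++⁻ u p))

Occurs-∷⁻ : Occurs (b ∷ u) s → Occurs u (shift s 1)
Occurs-∷⁻ {s = s} (at i (_ ∷ p)) = at i (Prefix-cong (λ j → cong s (+-suc i j)) p)

_⊆Fact_ : Word k → Word k → Set
s ⊆Fact s′ = ∀ {u} → Occurs u s → Occurs u s′

Factor-⊆ : s ⊆Fact s′ → Factor u s → Factor u s′
Factor-⊆ s⊆s′ = Occurs⇒Factor ∘ s⊆s′ ∘ Factor⇒Occurs _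

LeftSpecial-⊆ : s ⊆Fact s′ → LeftSpecial u s → LeftSpecial u s′
LeftSpecial-⊆ s⊆s′ (a , b , a≢b , au , bu) = a , b , a≢b , Factor-⊆ s⊆s′ au , Factor-⊆ s⊆s′ bu

occurs-reverse : MirrorClosed s → Occurs u s → Occurs (reverse u) s
occurs-reverse mirror = Factor⇒Occurs _ ∘ mirror _ ∘ Occurs⇒Factor

Episturmian-⊆⊇ : s ⊆Fact s′ → s′ ⊆Fact s → Episturmian s′ → Episturmian s
Episturmian-⊆⊇ s⊆s′ s′⊆s (mirror , unique) =
  (λ u → Factor-⊆ s′⊆s ∘ mirror u ∘ Factor-⊆ s⊆s′) ,
  (λ u v |u|≡|v| lsu lsv → unique u v |u|≡|v| (LeftSpecial-⊆ s⊆s′ lsu) (LeftSpecial-⊆ s⊆s′ lsv))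

-- The mirror image of a prefix that ends with reverse U followed by one more
-- letter contains U at a positive position.
pref-recurs : MirrorClosed s → ∀ n → Occurs (pref s n) (shift s 1)
pref-recurs {s = s} mirror n =
  Occurs-∷⁻ (Occurs-++⁻ˡ (y ∷ U) (subst (λ r → Occurs r s) reverse-V (occurs-reverse mirror (at 0 q))))
  where
  open ≡-Reasoning
  U : List (Fin _)
  U = pref s n
  reversed : Occurs (reverse U) s
  reversed = occurs-reverse mirror (at 0 (Prefix-pref s n))
  j : ℕ
  j = Occurs.position reversed
  y : Fin _
  y = shift s j (length (reverse U))
  V : List (Fin _)
  V = pref s j ++ reverse U ++ [ y ]
  q : Prefix V s
  q = Prefix-pref-++ s j (Prefix-++-next (Occurs.prefix reversed))
  reverse-V : reverse V ≡ y ∷ U ++ reverse (pref s j)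
  reverse-V = begin
    reverse V
      ≡⟨ reverse-++ (pref s j) _ ⟩
    reverse (reverse U ++ [ y ]) ++ reverse (pref s j)
      ≡⟨ cong (_++ reverse (pref s j)) (reverse-++ (reverse U) [ y ]) ⟩
    y ∷ reverse (reverse U) ++ reverse (pref s j)
      ≡⟨ cong (λ r → y ∷ r ++ reverse (pref s j)) (reverse-involutive U) ⟩
    y ∷ U ++ reverse (pref s j)
      ∎

mirrorClosed⇒recurrent : MirrorClosed s → s ⊆Fact shift s 1
mirrorClosed⇒recurrent         mirror (at (suc i) p) = at i p
mirrorClosed⇒recurrent {s = s} mirror {u} (at zero p) =
  subst (λ v → Occurs v (shift s 1)) (Prefix⇒IsPrefix p) (pref-recurs mirror (length u))

⊆-cons : ∀ c (w : Word k) → w ⊆Fact cons c w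
⊆-cons c w (at i p) = at (suc i) p

LeftExtension : Fin k → Word k → Set
LeftExtension c w = ∀ n → Occurs (c ∷ pref w n) w

LeftExtension-cong : s ≗ s′ → LeftExtension c s → LeftExtension c s′
LeftExtension-cong {s = s} {c = c} s≗s′ ext n =
  Occurs-cong s≗s′ (subst (λ v → Occurs (c ∷ v) s) (pref-cong s≗s′ n) (ext n))

LeftExtension⇒cons-⊆ : LeftExtension c w → cons c w ⊆Fact w
LeftExtension⇒cons-⊆ ext (at (suc i) p)   = at i p
LeftExtension⇒cons-⊆ ext (at zero [])     = at 0 []
LeftExtension⇒cons-⊆ {w = w} ext (at zero (c≡b ∷ p)) =
  subst (λ v → Occurs v w) (cong₂ _∷_ c≡b (Prefix⇒IsPrefix p)) (ext _)

cons-⊆⇒LeftExtension : cons c w ⊆Fact w → LeftExtension c w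
cons-⊆⇒LeftExtension {w = w} cw⊆w n = cw⊆w (at 0 (refl ∷ Prefix-pref w n))

MirrorClosed-cons⇒LeftExtension : MirrorClosed (cons c w) → LeftExtension c w
MirrorClosed-cons⇒LeftExtension mirror = cons-⊆⇒LeftExtension (mirrorClosed⇒recurrent mirror)

Episturmian-cons⇔LeftExtension : Episturmian w → Episturmian (cons c w) ⇔ LeftExtension c w
Episturmian-cons⇔LeftExtension {w = w} {c = c} epi = mk⇔
  (MirrorClosed-cons⇒LeftExtension ∘ proj₁)
  (λ ext → Episturmian-⊆⊇ (LeftExtension⇒cons-⊆ ext) (⊆-cons c w) epi)

pref-leftSpecial : c ≢ d → LeftExtension c w → LeftExtension d w → ∀ n → LeftSpecial (pref w n) w
pref-leftSpecial {c = c} {d = d} c≢d extc extd n =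
  c , d , c≢d , Occurs⇒Factor (extc n) , Occurs⇒Factor (extd n)

LeftSpecialsArePrefixes : Word k → Set
LeftSpecialsArePrefixes w = ∀ u → LeftSpecial u w → IsPrefix u w

epistandard : MirrorClosed w → LeftSpecialsArePrefixes w → Epistandard w
epistandard {w = w} mirror prefixes =
  (mirror , λ u v |u|≡|v| lsu lsv →
    trans (sym (prefixes u lsu)) (trans (cong (pref w) |u|≡|v|) (prefixes v lsv))) ,
  prefixes

Epistandard-two-cons : c ≢ d → Episturmian (cons c w) → Episturmian (cons d w) → Epistandard w
Epistandard-two-cons {c = c} {d = d} {w = w} c≢d epic epid = epi , prefixes
  where
  extc : LeftExtension c w
  extc = MirrorClosed-cons⇒LeftExtension (proj₁ epic)
  extd : LeftExtension d w
  extd = MirrorClosed-cons⇒LeftExtension (proj₁ epid)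
  epi : Episturmian w
  epi = Episturmian-⊆⊇ (⊆-cons c w) (LeftExtension⇒cons-⊆ extc) epic
  prefixes : LeftSpecialsArePrefixes w
  prefixes u lsu =
    proj₂ epi (pref w (length u)) u (length-pref w _) (pref-leftSpecial c≢d extc extd _) lsu

Image : Fin k → Word k → Word k → Set
Image a t s = ∀ n → Prefix (Lword a (pref t n)) s

IsLImage⇒Image : IsLImage a t s → Image a t s
IsLImage⇒Image img n = IsPrefix⇒Prefix _ (img n)

Image⇒IsLImage : Image a t s → IsLImage a t s
Image⇒IsLImage img n = Prefix⇒IsPrefix (img n)

-- s begins with the block L_a(b), followed by a word satisfying P.
data Block (a b : Fin k) (P : Word k → Set) (s : Word k) : Set where
  short : s 0 ≡ a → b ≡ a → P (shift s 1) → Block a b P s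
  long  : s 0 ≡ a → b ≢ a → s 1 ≡ b → P (shift s 2) → Block a b P s

Block-head : Block a b P s → s 0 ≡ a
Block-head (short s₀≡a _ _)  = s₀≡a
Block-head (long s₀≡a _ _ _) = s₀≡a

Block-map : (∀ {s} → P s → Q s) → Block a b P s → Block a b Q s
Block-map f (short s₀≡a b≡a p)     = short s₀≡a b≡a (f p)
Block-map f (long s₀≡a b≢a s₁≡b p) = long s₀≡a b≢a s₁≡b (f p)

Block-extract : {A : Set} → Block a b (λ _ → A) s → A
Block-extract (short _ _ x)  = x
Block-extract (long _ _ _ x) = x

Block-∀ : {P : ℕ → Word k → Set} →
          (∀ n → Block a b (P n) s) → Block a b (λ s′ → ∀ n → P n s′) s
Block-∀ {a = a} {b = b} {s = s} {P = P} blocks with blocks 0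
... | short s₀≡a b≡a _ = short s₀≡a b≡a (λ n → rest (blocks n))
  where
  rest : ∀ {n} → Block a b (P n) s → P n (shift s 1)
  rest (short _ _ p)    = p
  rest (long _ b≢a _ _) = ⊥-elim (b≢a b≡a)
... | long s₀≡a b≢a s₁≡b _ = long s₀≡a b≢a s₁≡b (λ n → rest (blocks n))
  where
  rest : ∀ {n} → Block a b (P n) s → P n (shift s 2)
  rest (short _ b≡a _) = ⊥-elim (b≢a b≡a)
  rest (long _ _ _ p)  = p

Block-unique : (∀ {s} → P s → s 0 ≡ a) → (∀ {s} → Q s → s 0 ≡ a) →
               Block a b P s → Block a c Q s → b ≡ c × Block a b (λ s′ → P s′ × Q s′) s
Block-unique headP headQ (short s₀≡a b≡a p) (short _ c≡a q) =
  trans b≡a (sym c≡a) , short s₀≡a b≡a (p , q)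
Block-unique headP headQ (short _ _ p) (long _ c≢a s₁≡c _) =
  ⊥-elim (c≢a (trans (sym s₁≡c) (headP p)))
Block-unique headP headQ (long _ b≢a s₁≡b _) (short _ _ q) =
  ⊥-elim (b≢a (trans (sym s₁≡b) (headQ q)))
Block-unique headP headQ (long s₀≡a b≢a s₁≡b p) (long _ _ s₁≡c q) =
  trans (sym s₁≡b) s₁≡c , long s₀≡a b≢a s₁≡b (p , q)

Block-occurs : Block a b (Prefix u) s → Occurs (b ∷ u) s
Block-occurs (short s₀≡a b≡a p) = at 0 (trans s₀≡a (sym b≡a) ∷ p)
Block-occurs (long _ _ s₁≡b p)   = at 1 (s₁≡b ∷ p)

Prefix-Lword∷⁻ : Prefix (Lword a (b ∷ v) ++ z) s → Block a b (Prefix (Lword a v ++ z)) s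
Prefix-Lword∷⁻ {a = a} {b = b} p with b ≟ a
Prefix-Lword∷⁻ (s₀≡a ∷ p)        | yes b≡a = short s₀≡a b≡a p
Prefix-Lword∷⁻ (s₀≡a ∷ s₁≡b ∷ p) | no b≢a  = long s₀≡a b≢a s₁≡b p

Prefix-Lword∷⁺ : Block a b (Prefix (Lword a v ++ z)) s → Prefix (Lword a (b ∷ v) ++ z) s
Prefix-Lword∷⁺ {a = a} {b = b} block with b ≟ a | block
... | yes _   | short s₀≡a _ p     = s₀≡a ∷ p
... | yes b≡a | long _ b≢a _ _     = ⊥-elim (b≢a b≡a)
... | no b≢a  | short _ b≡a _      = ⊥-elim (b≢a b≡a)
... | no _    | long s₀≡a _ s₁≡b p = s₀≡a ∷ s₁≡b ∷ p

Prefix-Lword∷⁻′ : Prefix (Lword a (b ∷ v)) s → Block a b (Prefix (Lword a v)) s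
Prefix-Lword∷⁻′ p = Block-map (proj₁ ∘ Prefix-++⁻ _) (Prefix-Lword∷⁻ (Prefix-++⁺ p []))

Prefix-Lword∷⁺′ : Block a b (Prefix (Lword a v)) s → Prefix (Lword a (b ∷ v)) s
Prefix-Lword∷⁺′ block =
  proj₁ (Prefix-++⁻ _ (Prefix-Lword∷⁺ (Block-map (λ p → Prefix-++⁺ p []) block)))

Prefix-Lword-head : Prefix (Lword a v ++ [ a ]) s → s 0 ≡ a
Prefix-Lword-head {v = []}    (s₀≡a ∷ _) = s₀≡a
Prefix-Lword-head {v = b ∷ v} p          = Block-head (Prefix-Lword∷⁻ {b = b} {v = v} p)

Image-unfold : Image a t s → Block a (t 0) (Image a (shift t 1)) s
Image-unfold img = Block-∀ (λ n → Prefix-Lword∷⁻′ (img (suc n)))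

Image-head : Image a t s → s 0 ≡ a
Image-head = Block-head ∘ Image-unfold

Image-shift : Image a t s → ∀ i → ∃[ p ] Image a (shift t i) (shift s p)
Image-shift img zero    = 0 , img
Image-shift img (suc i) with Image-unfold img
... | short _ _ img′  = let (p , img″) = Image-shift img′ i in suc p , img″
... | long _ _ _ img′ = let (p , img″) = Image-shift img′ i in 2 + p , img″

-- Position p of s = L_a(t) either starts the block of t i or is the second
-- letter of the block a (t i).
data Position (a : Fin k) (t s : Word k) (p : ℕ) : Set where
  boundary : ∀ i → Image a (shift t i) (shift s p) → Position a t s p
  interior : ∀ i → i < p → t i ≢ a → s p ≡ t i →
             Image a (shift t (suc i)) (shift s (suc p)) → Position a t s p

Position-suc : Position a (shift t 1) (shift s 1) p → Position a t s (suc p)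
Position-suc (boundary i img)                = boundary (suc i) img
Position-suc (interior i i<p tᵢ≢a sₚ≡tᵢ img) = interior (suc i) (s≤s i<p) tᵢ≢a sₚ≡tᵢ img

Position-suc-suc : Position a (shift t 1) (shift s 2) p → Position a t s (suc (suc p))
Position-suc-suc (boundary i img)                = boundary (suc i) img
Position-suc-suc (interior i i<p tᵢ≢a sₚ≡tᵢ img) =
  interior (suc i) (s≤s (m≤n⇒m≤1+n i<p)) tᵢ≢a sₚ≡tᵢ img

position : Image a t s → ∀ p → Position a t s p
position img zero    = boundary 0 img
position img (suc p) with Image-unfold img | p
... | short _ _ img′         | p       = Position-suc (position img′ p)
... | long _ t₀≢a s₁≡t₀ img′ | zero    = interior 0 z<s t₀≢a s₁≡t₀ img′
... | long _ _ _ img′        | suc p′  = Position-suc-suc (position img′ p′)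

Prefix-image : Image a t s → Prefix v t → Prefix (Lword a v ++ [ a ]) s
Prefix-image img []         = Image-head img ∷ []
Prefix-image {a = a} {t = t} {s = s} {v = _ ∷ v} img (t₀≡b ∷ p) =
  Prefix-Lword∷⁺ (subst (λ b → Block a b _ s) t₀≡b block)
  where
  block : Block a (t 0) (Prefix (Lword a v ++ [ a ])) s
  block = Block-map (λ img′ → Prefix-image img′ p) (Image-unfold img)

Prefix-preimage : Image a t s → Prefix (Lword a v ++ [ a ]) s → Prefix v t
Prefix-preimage {v = []}    img _ = []
Prefix-preimage {v = b ∷ v} img p
  with Block-unique (Prefix-Lword-head {v = v}) Image-head (Prefix-Lword∷⁻ {b = b} p) (Image-unfold img)
... | b≡t₀ , blocks =
  sym b≡t₀ ∷ Block-extract (Block-map (λ (q , img′) → Prefix-preimage {v = v} img′ q) blocks)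

Prefix-preimage-∷ : Image a t s → Prefix (c ∷ Lword a v ++ [ a ]) s → Prefix (c ∷ v) t
Prefix-preimage-∷ img (s₀≡c ∷ p) =
  Prefix-preimage img (Prefix-Lword∷⁺ (short (Image-head img) (trans (sym s₀≡c) (Image-head img)) p))

Occurs-image : Image a t s → Occurs v t → Occurs (Lword a v ++ [ a ]) s
Occurs-image img (at i p) = let (q , img′) = Image-shift img i in at q (Prefix-image img′ p)

Occurs-image-∷ : Image a t s → Occurs (c ∷ v) t → Occurs (c ∷ Lword a v ++ [ a ]) s
Occurs-image-∷ img (at i p) =
  let (q , img′) = Image-shift img i
  in Occurs-shift q (Block-occurs (Prefix-Lword∷⁻ (Prefix-image img′ p)))

Occurs-preimage : Image a t s → Occurs (Lword a v ++ [ a ]) s → Occurs v t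
Occurs-preimage {s = s} {v = v} img (at p q) with position img p
... | boundary i img′            = at i (Prefix-preimage img′ q)
... | interior i _ tᵢ≢a sₚ≡tᵢ _ =
  ⊥-elim (tᵢ≢a (trans (sym sₚ≡tᵢ) (trans (sym (shift-0 s p)) (Prefix-Lword-head {v = v} q))))

Lword-++ : ∀ (a : Fin k) u v → Lword a (u ++ v) ≡ Lword a u ++ Lword a v
Lword-++ a []      v = refl
Lword-++ a (b ∷ u) v with b ≟ a
... | yes _ = cong (a ∷_) (Lword-++ a u v)
... | no _  = cong (λ r → a ∷ b ∷ r) (Lword-++ a u v)

Lword-∷-++ : ∀ (a : Fin k) b u z → Lword a (b ∷ u) ++ z ≡ Lword a [ b ] ++ Lword a u ++ z
Lword-∷-++ a b u z with b ≟ a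
... | yes _ = refl
... | no _  = refl

∷-reverse-Lword-[] : ∀ (a : Fin k) b → a ∷ reverse (Lword a [ b ]) ≡ Lword a [ b ] ++ [ a ]
∷-reverse-Lword-[] a b with b ≟ a
... | yes _ = refl
... | no _  = refl

reverse-Lword-++ : ∀ (a : Fin k) u → reverse (Lword a u ++ [ a ]) ≡ Lword a (reverse u) ++ [ a ]
reverse-Lword-++ a []      = refl
reverse-Lword-++ a (b ∷ u) = begin
  reverse (Lword a (b ∷ u) ++ [ a ])
    ≡⟨ cong reverse (Lword-∷-++ a b u [ a ]) ⟩
  reverse (Lword a [ b ] ++ Lword a u ++ [ a ])
    ≡⟨ reverse-++ (Lword a [ b ]) _ ⟩
  reverse (Lword a u ++ [ a ]) ++ reverse (Lword a [ b ])
    ≡⟨ cong (_++ reverse (Lword a [ b ])) (reverse-Lword-++ a u) ⟩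
  (Lword a (reverse u) ++ [ a ]) ++ reverse (Lword a [ b ])
    ≡⟨ ++-assoc (Lword a (reverse u)) [ a ] _ ⟩
  Lword a (reverse u) ++ a ∷ reverse (Lword a [ b ])
    ≡⟨ cong (Lword a (reverse u) ++_) (∷-reverse-Lword-[] a b) ⟩
  Lword a (reverse u) ++ Lword a [ b ] ++ [ a ]
    ≡⟨ ++-assoc (Lword a (reverse u)) (Lword a [ b ]) [ a ] ⟨
  (Lword a (reverse u) ++ Lword a [ b ]) ++ [ a ]
    ≡⟨ cong (_++ [ a ]) (Lword-++ a (reverse u) [ b ]) ⟨
  Lword a (reverse u ++ [ b ]) ++ [ a ]
    ≡⟨ cong (λ r → Lword a r ++ [ a ]) (unfold-reverse b u) ⟨
  Lword a (reverse (b ∷ u)) ++ [ a ]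
    ∎
  where open ≡-Reasoning

MirrorClosed-preimage : Image a t s → MirrorClosed s → MirrorClosed t
MirrorClosed-preimage {a = a} {s = s} img mirror u =
  Occurs⇒Factor ∘ Occurs-preimage {v = reverse u} img ∘ subst (λ r → Occurs r s) (reverse-Lword-++ a u) ∘
  occurs-reverse mirror ∘ Occurs-image img ∘ Factor⇒Occurs u

LeftSpecialsArePrefixes-preimage : Image a t s → LeftSpecialsArePrefixes s → LeftSpecialsArePrefixes t
LeftSpecialsArePrefixes-preimage {a = a} {s = s} img prefixes u (b , c , b≢c , bu , cu) =
  Prefix⇒IsPrefix (Prefix-preimage {v = u} img (IsPrefix⇒Prefix _ (prefixes _ image-special)))
  where
  image-special : LeftSpecial (Lword a u ++ [ a ]) s
  image-special = b , c , b≢c , Occurs⇒Factor (Occurs-image-∷ img (Factor⇒Occurs _ bu)) ,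
                              Occurs⇒Factor (Occurs-image-∷ img (Factor⇒Occurs _ cu))

Epistandard-preimage : Image a t s → Epistandard s → Epistandard t
Epistandard-preimage img ((mirror , _) , prefixes) =
  epistandard (MirrorClosed-preimage img mirror) (LeftSpecialsArePrefixes-preimage img prefixes)

LeftExtension-preimage : Image a t s → LeftExtension c s → LeftExtension c t
LeftExtension-preimage {a = a} {t = t} {s = s} {c = c} img ext m =
  preimage (subst (λ r → Occurs (c ∷ r) s) pref-image (ext (length image)))
  where
  image : List (Fin _)
  image = Lword a (pref t m) ++ [ a ]
  pref-image : pref s (length image) ≡ image
  pref-image = Prefix⇒IsPrefix (Prefix-image img (Prefix-pref t m))
  preimage : Occurs (c ∷ image) s → Occurs (c ∷ pref t m) t
  preimage (at p q) with position img p
  ... | boundary i img′ = at i (Prefix-preimage-∷ img′ q)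
  ... | interior i _ _ sₚ≡tᵢ img′ =
    let (sₚ≡c , q′) = Prefix-∷-shift⁻ s p q
    in at i (Prefix-∷-shift⁺ t i (trans (sym sₚ≡tᵢ) sₚ≡c) (Prefix-preimage img′ q′))

occurrence-preimage : Image a t s → c ≢ a → s p ≡ c → ∃[ i ] i < p × t i ≡ c
occurrence-preimage {s = s} {p = p} img c≢a sₚ≡c with position img p
... | boundary i img′ =
  ⊥-elim (c≢a (trans (sym sₚ≡c) (trans (sym (shift-0 s p)) (Image-head img′))))
... | interior i i<p _ sₚ≡tᵢ _ = i , i<p , trans (sym sₚ≡tᵢ) sₚ≡c

Separating : Fin k → Word k → Set
Separating a s = ∀ j → s (suc j) ≢ a → s j ≡ a

first-letter-recurs : MirrorClosed s → ∀ j → ∃[ i ] s (i + j) ≡ s 0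
first-letter-recurs {s = s} mirror j =
  last-letter (occurs-reverse mirror (at 0 (Prefix-pref s (suc j))))
  where
  R : List (Fin _)
  R = pref (shift s 1) j
  |R|+0≡j : length (reverse R) + 0 ≡ j
  |R|+0≡j = trans (+-identityʳ _) (trans (length-reverse R) (length-pref (shift s 1) j))
  last-letter : Occurs (reverse (s 0 ∷ R)) s → ∃[ i ] s (i + j) ≡ s 0
  last-letter (at i q)
    with Prefix-++⁻ (reverse R) (subst (λ r → Prefix r (shift s i)) (unfold-reverse (s 0) R) q)
  ... | _ , (last ∷ []) = i , trans (cong (λ l → s (i + l)) (sym |R|+0≡j)) last

-- By mirror closure, two successors of b would make b left special, i.e. b = s 0.
unique-successor : MirrorClosed s → LeftSpecialsArePrefixes s →
                   b ≢ s 0 → Occurs (b ∷ c ∷ []) s → Occurs (b ∷ d ∷ []) s → c ≡ d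
unique-successor {s = s} {b = b} {c = c} {d = d} mirror prefixes b≢s₀ bc bd with c ≟ d
... | yes c≡d = c≡d
... | no c≢d  = ⊥-elim (b≢s₀ (sym (proj₁ (∷-injective (prefixes _ [b]-special)))))
  where
  [b]-special : LeftSpecial (b ∷ []) s
  [b]-special =
    c , d , c≢d , Occurs⇒Factor (occurs-reverse mirror bc) , Occurs⇒Factor (occurs-reverse mirror bd)

-- If neither s j nor s (j + 1) were s 0, their unique successors would keep s
-- alternating between them from j on, but s 0 recurs after j.
separating : MirrorClosed s → LeftSpecialsArePrefixes s → Separating (s 0) s
separating {s = s} mirror prefixes j sⱼ₊₁≢s₀ =
  decidable-stable (s j ≟ s 0) λ sⱼ≢s₀ → never-returns sⱼ≢s₀ (first-letter-recurs {s = s} mirror j)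
  where
  pair : ∀ q → s q ≡ b → Occurs (b ∷ s (suc q) ∷ []) s
  pair q s_q≡b = at q (Prefix-∷-shift⁺ s q s_q≡b (Prefix-∷-shift⁺ s (suc q) refl []))
  forth : Occurs (s j ∷ s (suc j) ∷ []) s
  forth = pair j refl
  back : Occurs (s (suc j) ∷ s j ∷ []) s
  back = occurs-reverse mirror forth
  alternates : s j ≢ s 0 → ∀ i → s (i + j) ≡ s j ⊎ s (i + j) ≡ s (suc j)
  alternates sⱼ≢s₀ zero    = inj₁ refl
  alternates sⱼ≢s₀ (suc i) with alternates sⱼ≢s₀ i
  ... | inj₁ ≡sⱼ   = inj₂ (unique-successor mirror prefixes sⱼ≢s₀ (pair (i + j) ≡sⱼ) forth)
  ... | inj₂ ≡sⱼ₊₁ = inj₁ (unique-successor mirror prefixes sⱼ₊₁≢s₀ (pair (i + j) ≡sⱼ₊₁) back)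
  never-returns : s j ≢ s 0 → ¬ (∃[ i ] s (i + j) ≡ s 0)
  never-returns sⱼ≢s₀ (i , s₀-again) with alternates sⱼ≢s₀ i
  ... | inj₁ ≡sⱼ   = sⱼ≢s₀ (trans (sym ≡sⱼ) s₀-again)
  ... | inj₂ ≡sⱼ₊₁ = sⱼ₊₁≢s₀ (trans (sym ≡sⱼ₊₁) s₀-again)

blockLength : {A : Set} → Dec A → ℕ
blockLength (yes _) = 1
blockLength (no _)  = 2

-- The block of L_a starting at s 0 = a encodes the letter s 1: it is a itself
-- when s 1 = a, and a (s 1) otherwise.
decode : Fin k → Word k → Word k
decode a s zero    = s 1
decode a s (suc i) = decode a (shift s (blockLength (s 1 ≟ a))) i

decode-image : s 0 ≡ a → Separating a s → Image a (decode a s) s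
decode-image             s₀≡a separated zero    = []
decode-image {s = s} {a = a} s₀≡a separated (suc n) = Prefix-Lword∷⁺′ (block (s 1 ≟ a))
  where
  block : (s₁≟a : Dec (s 1 ≡ a)) →
          Block a (s 1) (Prefix (Lword a (pref (decode a (shift s (blockLength s₁≟a))) n))) s
  block (yes s₁≡a) = short s₀≡a s₁≡a (decode-image s₁≡a (separated ∘ suc) n)
  block (no s₁≢a)  = long s₀≡a s₁≢a refl (decode-image s₂≡a (separated ∘ suc ∘ suc) n)
    where
    s₂≡a : s 2 ≡ a
    s₂≡a = decidable-stable (s 2 ≟ a) (λ s₂≢a → s₁≢a (separated 1 s₂≢a))

desubstitute : Word k → Word k
desubstitute s = decode (s 0) s

desubstitute-image : Epistandard s → Image (s 0) (desubstitute s) s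
desubstitute-image {s = s} ((mirror , _) , prefixes) = decode-image refl (separating {s = s} mirror prefixes)

ancestor : Word k → ℕ → Word k
ancestor w zero    = w
ancestor w (suc n) = desubstitute (ancestor w n)

Epistandard-ancestor : Epistandard w → ∀ n → Epistandard (ancestor w n)
Epistandard-ancestor ep zero    = ep
Epistandard-ancestor ep (suc n) =
  Epistandard-preimage (desubstitute-image (Epistandard-ancestor ep n)) (Epistandard-ancestor ep n)

Epistandard⇒Directive : Epistandard w → Directive w (λ n → ancestor w n 0)
Epistandard⇒Directive {w = w} ep =
  ancestor w , (λ _ → refl) , λ n → Image⇒IsLImage (desubstitute-image (Epistandard-ancestor ep n))

length-Lword-++ : ∀ (a : Fin k) v → suc (length v) ≤ length (Lword a v ++ [ a ])
length-Lword-++ a []      = s≤s z≤n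
length-Lword-++ a (b ∷ v) with b ≟ a
... | yes _ = s≤s (length-Lword-++ a v)
... | no _  = s≤s (m≤n⇒m≤1+n (length-Lword-++ a v))

module _ {k : ℕ} {w : Word k} {x : ℕ → Fin k} (directive : Directive w x) where

  private
    s⁽_⁾ : ℕ → Word k
    s⁽_⁾ = proj₁ directive

    s⁽0⁾≗w : s⁽ 0 ⁾ ≗ w
    s⁽0⁾≗w = proj₁ (proj₂ directive)

    image : ∀ n → Image (x n) s⁽ suc n ⁾ s⁽ n ⁾
    image n = IsLImage⇒Image (proj₂ (proj₂ directive) n)

  LeftExtension-ancestors : LeftExtension c w → ∀ n → LeftExtension c s⁽ n ⁾
  LeftExtension-ancestors ext zero    = LeftExtension-cong (sym ∘ s⁽0⁾≗w) ext
  LeftExtension-ancestors ext (suc n) = LeftExtension-preimage (image n) (LeftExtension-ancestors ext n)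

  directive-letter-later : ∀ n p → s⁽ n ⁾ p ≡ c → Acc _<_ p → ∃[ m ] n ≤ m × x m ≡ c
  directive-letter-later {c = c} n p sₚ≡c (acc smaller) with x n ≟ c
  ... | yes xₙ≡c = n , ≤-refl , xₙ≡c
  ... | no xₙ≢c  =
    let (i , i<p , sᵢ≡c) = occurrence-preimage (image n) (≢-sym xₙ≢c) sₚ≡c
        (m , n<m , xₘ≡c) = directive-letter-later (suc n) i sᵢ≡c (smaller i<p)
    in m , <⇒≤ n<m , xₘ≡c

  LeftExtension⇒InfOften : LeftExtension c w → InfOften x c
  LeftExtension⇒InfOften ext n with LeftExtension-ancestors ext n 0
  ... | at p (sₚ≡c ∷ []) = directive-letter-later n (p + 0) sₚ≡c (<-wellFounded _)

  -- L_{x n} maps a prefix v extended by c to the prefix L_{x n}(v) x n, again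
  -- extended by c.
  long-extended-prefix : ∀ K n → x (K + n) ≡ c →
                         ∃[ v ] Occurs (c ∷ v) s⁽ n ⁾ × Prefix v s⁽ n ⁾ × K ≤ length v
  long-extended-prefix zero n xₙ≡c =
    [] , at 0 (trans (Image-head (image n)) xₙ≡c ∷ []) , [] , z≤n
  long-extended-prefix {c = c} (suc K) n x≡c =
    let (v , cv , pv , K≤|v|) =
          long-extended-prefix K (suc n) (subst (λ l → x l ≡ c) (sym (+-suc K n)) x≡c)
    in Lword (x n) v ++ [ x n ] , Occurs-image-∷ (image n) cv , Prefix-image (image n) pv ,
       ≤-trans (s≤s K≤|v|) (length-Lword-++ (x n) v)

  InfOften⇒LeftExtension : InfOften x c → LeftExtension c w
  InfOften⇒LeftExtension {c = c} often = LeftExtension-cong s⁽0⁾≗w ext₀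
    where
    ext₀ : LeftExtension c s⁽ 0 ⁾
    ext₀ m with often m
    ... | N , m≤N , x≡c with long-extended-prefix N 0 (subst (λ l → x l ≡ c) (sym (+-identityʳ N)) x≡c)
    ...   | v , at i (sᵢ≡c ∷ q) , pv , N≤|v| =
      at i (sᵢ≡c ∷ Prefix-pref-≤ s⁽ 0 ⁾ (≤-trans m≤N N≤|v|) q′)
      where
      q′ : Prefix (pref s⁽ 0 ⁾ (length v)) (shift (shift s⁽ 0 ⁾ i) 1)
      q′ = subst (λ r → Prefix r _) (sym (Prefix⇒IsPrefix pv)) q

  InfOften⇔LeftExtension : InfOften x c ⇔ LeftExtension c w
  InfOften⇔LeftExtension = mk⇔ InfOften⇒LeftExtension LeftExtension⇒InfOften

Episturmian-cons⇔InfOften : Episturmian w → Directive w x → Episturmian (cons c w) ⇔ InfOften x c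
Episturmian-cons⇔InfOften epi directive =
  ⇔-trans (Episturmian-cons⇔LeftExtension epi) (⇔-sym (InfOften⇔LeftExtension directive))

theorem6 : ∀ {k : ℕ} (w : Word k) (B : Subset k) → TwoLetters B →
    (UltStrictEpistandard w B ⇔ (∀ (a : Fin k) → Episturmian (cons a w) ⇔ a ∈ B))
theorem6 w B (a , b , a≢b , a∈B , b∈B) = mk⇔ strict⇒cons cons⇒strict
  where
  strict⇒cons : UltStrictEpistandard w B → ∀ c → Episturmian (cons c w) ⇔ c ∈ B
  strict⇒cons ((epi , _) , x , directive , ult) c =
    ⇔-trans (Episturmian-cons⇔InfOften epi directive) (ult c)
  cons⇒strict : (∀ c → Episturmian (cons c w) ⇔ c ∈ B) → UltStrictEpistandard w B
  cons⇒strict cons⇔∈B = ep , _ , directive , λ c →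
    ⇔-trans (⇔-sym (Episturmian-cons⇔InfOften (proj₁ ep) directive)) (cons⇔∈B c)
    where
    ep : Epistandard w
    ep = Epistandard-two-cons a≢b (Equivalence.from (cons⇔∈B a) a∈B) (Equivalence.from (cons⇔∈B b) b∈B)
    directive : Directive w (λ n → ancestor w n 0)
    directive = Epistandard⇒Directive ep
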